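{- Let $n\ge3$ and let $\mathcal J,\mathcal K$ be maximal tubings of $C_n$. Then $\mathrm{inv}(\mathcal J)=\mathrm{inv}(\mathcal K)$ if and only if $\mathcal J=\mathcal K$.
   Context: A tube of a graph on $[n]$ is a nonempty vertex set inducing a connected subgraph; tubes $X,Y$ are compatible if $X\subseteq Y$, $Y\subseteq X$, or $X\cup Y$ is not a tube; a maximal tubing is an inclusion-maximal set of pairwise compatible tubes. For a maximal tubing $\mathcal T$ and $x\in[n]$, $\mathcal T_\downarrow(x)$ is the smallest tube of $\mathcal T$ containing $x$. The $G$-tree of $\mathcal T$ is the order $x\le_{\mathcal T}y$ iff $x\in\mathcal T_\downarrow(y)$, and $\mathrm{inv}(\mathcal T)=\{(i,j):i<j,\ j<_{\mathcal T}i\}$. $C_n$ is the cycle with edges $\{i,i+1\}$ and $\{n,1\}$. -}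

module Defs where

open import Data.Nat using (ℕ; suc; _≤_)
open import Data.Fin using (Fin; toℕ; _<_)
open import Data.Fin.Subset using (Subset; _∈_; _∉_; _⊆_; _∪_; Nonempty)
open import Data.Bool using (Bool; true)
open import Data.Product using (_×_; ∃)
open import Data.Sum using (_⊎_)
open import Relation.Nullary using (¬_)
open import Relation.Binary.PropositionalEquality using (_≡_)

Graph : ℕ → Set₁
Graph n = Fin n → Fin n → Set

-- The cycle C_n on [n] = {1,…,n}, encoded on Fin n by i ↦ i+1:
-- edges {i,i+1} and {n,1}.
Cycle : (n : ℕ) → Graph n
Cycle n i j =
  (toℕ j ≡ suc (toℕ i)) ⊎ (toℕ i ≡ suc (toℕ j))
  ⊎ ((suc (toℕ i) ≡ n × toℕ j ≡ 0) ⊎ (toℕ i ≡ 0 × suc (toℕ j) ≡ n))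

data Reach {n : ℕ} (G : Graph n) (X : Subset n) : Fin n → Fin n → Set where
  here : ∀ {x} → x ∈ X → Reach G X x x
  step : ∀ {x y z} → x ∈ X → G x y → Reach G X y z → Reach G X x z

Connected : {n : ℕ} → Graph n → Subset n → Set
Connected G X = ∀ x y → x ∈ X → y ∈ X → Reach G X x y

Tube : {n : ℕ} → Graph n → Subset n → Set
Tube G X = Nonempty X × Connected G X

Compatible : {n : ℕ} → Graph n → Subset n → Subset n → Set
Compatible G X Y = X ⊆ Y ⊎ Y ⊆ X ⊎ ¬ Tube G (X ∪ Y)

SetOfSubsets : ℕ → Set
SetOfSubsets n = Subset n → Bool

_∈ₛ_ : {n : ℕ} → Subset n → SetOfSubsets n → Set
X ∈ₛ T = T X ≡ true

IsTubing : {n : ℕ} → Graph n → SetOfSubsets n → Set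
IsTubing G T =
  (∀ X → X ∈ₛ T → Tube G X)
  × (∀ X Y → X ∈ₛ T → Y ∈ₛ T → Compatible G X Y)

IsMaximalTubing : {n : ℕ} → Graph n → SetOfSubsets n → Set
IsMaximalTubing G T =
  IsTubing G T
  × (∀ T' → IsTubing G T' → (∀ X → X ∈ₛ T → X ∈ₛ T') → ∀ X → X ∈ₛ T' → X ∈ₛ T)

IsSmallestTube : {n : ℕ} → SetOfSubsets n → Fin n → Subset n → Set
IsSmallestTube T x X = X ∈ₛ T × x ∈ X × (∀ Y → Y ∈ₛ T → x ∈ Y → X ⊆ Y)

_≤[_]_ : {n : ℕ} → Fin n → SetOfSubsets n → Fin n → Set
x ≤[ T ] y = ∃ λ X → IsSmallestTube T y X × x ∈ X

_<[_]_ : {n : ℕ} → Fin n → SetOfSubsets n → Fin n → Set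
x <[ T ] y = x ≤[ T ] y × ¬ (x ≡ y)

Inv : {n : ℕ} → SetOfSubsets n → Fin n → Fin n → Set
Inv T i j = i < j × j <[ T ] i

{-# OPTIONS --safe #-}
-- For a maximal tubing T, the map x ↦ T↓(x) is a bijection from the vertices onto the
-- tubes of T. It is injective because if T↓(b) = T↓(j) = X with b ≠ j, then the component
-- of b in X − j is compatible with every tube of T, so by maximality it lies in T. Then it
-- contains X = T↓(b), which includes j, a contradiction. So a maximal tubing is determined
-- by its sets T↓(j), and the inversions determine those sets. If i ∈ J↓(j) but
-- i ∉ K↓(j), then a path from j to i inside J↓(j) leaves K↓(j) along an edge to some b.
-- That gives b <_J j and j <_K b, and whichever of b, j is smaller, the pair is an
-- inversion of exactly one of J and K.
module Submission where

open import Defs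
open import Data.Nat using (ℕ; _≤_)
open import Data.Fin using (Fin)
open import Data.Fin.Subset using (Subset)
open import Function.Bundles using (_⇔_)

open import Data.Nat as ℕ using (zero; suc; _+_)
open import Data.Nat.Properties using (+-suc; +-identityʳ; m≤n+m; ≤-<-trans)
open import Data.Fin using (toℕ; fromℕ<)
open import Data.Fin.Properties using (toℕ-injective; toℕ-fromℕ<; toℕ<n; any?; <-cmp; _≟_)
open import Data.Fin.Subset using (_∈_; _∉_; _⊆_; _⊂_; _∪_; _-_; ⊤; ⁅_⁆; Nonempty)
open import Data.Fin.Subset.Properties
  using (_∈?_; _⊆?_; _⊂?_; anySubset?; ∈⊤; ⊆⊤; ⊆-trans; ⊆-antisym; ⊂-irref; ⊆-⊂-trans;
         p⊆p∪q; q⊆p∪q; ∪-comm; x∈p∪q⁻; x∈⁅x⁆; x∈⁅y⁆⇒x≡y; p─q⊆p; x∈p∧x≢y⇒x∈p-y; x∈p⇒p-x⊂p)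
open import Data.Fin.Subset.Induction using (⊂-wellFounded; ⊃-wellFounded)
open import Data.Bool using (true; false; _∨_)
import Data.Bool as Bool
open import Data.Bool.Properties using (∨-zeroʳ)
open import Data.Vec.Properties using (≡-dec)
open import Data.Product using (∃; ∃₂; _×_; _,_; proj₁; proj₂; map₂)
open import Data.Sum using (_⊎_; inj₁; inj₂; [_,_]′)
open import Data.Empty using (⊥; ⊥-elim)
open import Function using (_∘_; id)
open import Function.Bundles using (mk⇔; Equivalence)
open Equivalence using (to; from)
import Function.Properties.Equivalence as ⇔
open import Induction.WellFounded using (WellFounded; Acc; acc)
open import Relation.Binary.Core using (Rel)
open import Relation.Binary.Definitions using (Symmetric; Decidable; tri<; tri≈; tri>)
open import Relation.Binary.PropositionalEquality using (_≡_; _≢_; refl; sym; trans; cong; subst)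
open import Relation.Nullary using (¬_; yes; no)
open import Relation.Nullary.Decidable using (_×-dec_; _⊎-dec_; ¬?; isYes)
open import Relation.Unary using (Pred)

module _ {a ℓ p q} {A : Set a} {_≺_ : Rel A ℓ} {P : Pred A p} {Q : Pred A q} where

  descend : WellFounded _≺_ → (∀ {x} → P x → (∃ λ y → y ≺ x × P y) ⊎ Q x)
          → ∀ {x} → P x → ∃ Q
  descend wf next {x} = go (wf x)
    where
    go : ∀ {x} → Acc _≺_ x → P x → ∃ Q
    go (acc rs) px with next px
    ... | inj₁ (y , y≺x , py) = go (rs y≺x) py
    ... | inj₂ qx = _ , qx

module _ {n : ℕ} where

  ⊆∧⊄⇒⊇ : {X Y : Subset n} → X ⊆ Y → ¬ X ⊂ Y → Y ⊆ X
  ⊆∧⊄⇒⊇ {X} X⊆Y X⊄Y {v} v∈Y with v ∈? X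
  ... | yes v∈X = v∈X
  ... | no v∉X = ⊥-elim (X⊄Y (X⊆Y , v , v∈Y , v∉X))

  ⊂-∪⁅⁆ : {x : Fin n} {X : Subset n} → x ∉ X → X ⊂ X ∪ ⁅ x ⁆
  ⊂-∪⁅⁆ {x} {X} x∉X = p⊆p∪q _ , x , q⊆p∪q X _ (x∈⁅x⁆ x) , x∉X

  ⁅x⁆⊆ : {x : Fin n} {X : Subset n} → x ∈ X → ⁅ x ⁆ ⊆ X
  ⁅x⁆⊆ {x} x∈X v∈⁅x⁆ = subst (_∈ _) (sym (x∈⁅y⁆⇒x≡y x v∈⁅x⁆)) x∈X

module _ {n : ℕ} {G : Graph n} where

  private
    variable
      X Y S : Subset n
      x y z : Fin n

  reach-source : Reach G X x y → x ∈ X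
  reach-source (here x∈X) = x∈X
  reach-source (step x∈X _ _) = x∈X

  reach-mono : X ⊆ Y → Reach G X x y → Reach G Y x y
  reach-mono X⊆Y (here x∈X) = here (X⊆Y x∈X)
  reach-mono X⊆Y (step x∈X e r) = step (X⊆Y x∈X) e (reach-mono X⊆Y r)

  infixr 5 _◅◅_
  _◅◅_ : Reach G X x y → Reach G X y z → Reach G X x z
  here _ ◅◅ r = r
  step x∈X e r ◅◅ r′ = step x∈X e (r ◅◅ r′)

  reach-reverse : Symmetric G → Reach G X x y → Reach G X y x
  reach-reverse G-sym (here x∈X) = here x∈X
  reach-reverse G-sym (step x∈X e r) =
    reach-reverse G-sym r ◅◅ step (reach-source r) (G-sym e) (here x∈X)

  reach-exit : Reach G X x y → x ∈ S → y ∉ S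
             → ∃₂ λ p q → p ∈ S × q ∉ S × q ∈ X × G p q
  reach-exit (here _) x∈S y∉S = ⊥-elim (y∉S x∈S)
  reach-exit {S = S} (step {y = w} _ e r) x∈S y∉S with w ∈? S
  ... | yes w∈S = reach-exit r w∈S y∉S
  ... | no w∉S = _ , w , x∈S , w∉S , reach-source r , e

module _ {n : ℕ} where

  private
    variable
      J K T : SetOfSubsets n
      X Y : Subset n
      x y : Fin n

  smallest-∈ₛ : IsSmallestTube T x X → X ∈ₛ T
  smallest-∈ₛ = proj₁

  smallest-∋ : IsSmallestTube T x X → x ∈ X
  smallest-∋ = proj₁ ∘ proj₂

  smallest-minimal : IsSmallestTube T x X → Y ∈ₛ T → x ∈ Y → X ⊆ Y
  smallest-minimal (_ , _ , minimal) = minimal _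

  insert : Subset n → SetOfSubsets n → SetOfSubsets n
  insert Y T Z = T Z ∨ isYes (≡-dec Bool._≟_ Z Y)

  ∈-insert-self : ∀ T Y → Y ∈ₛ insert Y T
  ∈-insert-self T Y with ≡-dec Bool._≟_ Y Y
  ... | yes _ = ∨-zeroʳ (T Y)
  ... | no Y≢Y = ⊥-elim (Y≢Y refl)

  ∈-insert⁺ : ∀ T Y {X} → X ∈ₛ T → X ∈ₛ insert Y T
  ∈-insert⁺ T Y {X} X∈T with T X
  ∈-insert⁺ T Y refl | true = refl

  ∈-insert⁻ : ∀ T Y X → X ∈ₛ insert Y T → X ∈ₛ T ⊎ X ≡ Y
  ∈-insert⁻ T Y X X∈ with T X | ≡-dec Bool._≟_ X Y
  ... | true | _ = inj₁ refl
  ... | false | yes X≡Y = inj₂ X≡Y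
  ∈-insert⁻ _ _ _ () | false | no _

  SameTubes : SetOfSubsets n → SetOfSubsets n → Set
  SameTubes J K = ∀ X → X ∈ₛ J ⇔ X ∈ₛ K

  SameInversions : SetOfSubsets n → SetOfSubsets n → Set
  SameInversions J K = ∀ i j → Inv J i j ⇔ Inv K i j

  Inv-transfer : SameTubes J K → ∀ {i j} → Inv J i j → Inv K i j
  Inv-transfer same (i<j , (X , (X∈J , j∈X , minimal) , i∈X) , j≢i) =
    i<j , (X , (to (same X) X∈J , j∈X , λ Y Y∈K → minimal Y (from (same Y) Y∈K)) , i∈X) , j≢i

  SameTubes-sym : SameTubes J K → SameTubes K J
  SameTubes-sym same X = ⇔.sym (same X)

  SameInversions-sym : SameInversions J K → SameInversions K J
  SameInversions-sym same i j = ⇔.sym (same i j)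

  Inv⇒≤ : ∀ {i j} → Inv T i j → j ≤[ T ] i
  Inv⇒≤ = proj₁ ∘ proj₂

module Tubes {n : ℕ} (G : Graph n) (G-sym : Symmetric G) (G? : Decidable G) where

  private
    variable
      T : SetOfSubsets n
      W X X′ Y Z : Subset n
      b j u v x y : Fin n

  Touch : Subset n → Subset n → Set
  Touch X Y = (∃ λ v → v ∈ X × v ∈ Y) ⊎ (∃₂ λ u v → u ∈ X × v ∈ Y × G u v)

  touch-monoˡ : X ⊆ X′ → Touch X Y → Touch X′ Y
  touch-monoˡ X⊆X′ (inj₁ (v , v∈X , v∈Y)) = inj₁ (v , X⊆X′ v∈X , v∈Y)
  touch-monoˡ X⊆X′ (inj₂ (u , v , u∈X , v∈Y , e)) = inj₂ (u , v , X⊆X′ u∈X , v∈Y , e)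

  bridge : Connected G X → Connected G Y → Touch X Y → x ∈ X → y ∈ Y → Reach G (X ∪ Y) x y
  bridge {X} {Y} cX cY (inj₁ (v , v∈X , v∈Y)) x∈X y∈Y =
    reach-mono (p⊆p∪q Y) (cX _ _ x∈X v∈X) ◅◅ reach-mono (q⊆p∪q X Y) (cY _ _ v∈Y y∈Y)
  bridge {X} {Y} cX cY (inj₂ (u , v , u∈X , v∈Y , e)) x∈X y∈Y =
    reach-mono (p⊆p∪q Y) (cX _ _ x∈X u∈X)
      ◅◅ step (p⊆p∪q Y u∈X) e (reach-mono (q⊆p∪q X Y) (cY _ _ v∈Y y∈Y))

  connected-∪ : Connected G X → Connected G Y → Touch X Y → Connected G (X ∪ Y)
  connected-∪ {X} {Y} cX cY t u v u∈ v∈ with x∈p∪q⁻ X Y u∈ | x∈p∪q⁻ X Y v∈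
  ... | inj₁ u∈X | inj₁ v∈X = reach-mono (p⊆p∪q Y) (cX u v u∈X v∈X)
  ... | inj₂ u∈Y | inj₂ v∈Y = reach-mono (q⊆p∪q X Y) (cY u v u∈Y v∈Y)
  ... | inj₁ u∈X | inj₂ v∈Y = bridge cX cY t u∈X v∈Y
  ... | inj₂ u∈Y | inj₁ v∈X = reach-reverse G-sym (bridge cX cY t v∈X u∈Y)

  connected-⁅⁆ : Connected G ⁅ x ⁆
  connected-⁅⁆ {x} u v u∈ v∈ with x∈⁅y⁆⇒x≡y x u∈ | x∈⁅y⁆⇒x≡y x v∈
  ... | refl | refl = here u∈

  touch-of-connected-∪ : Nonempty X → Nonempty Y → Connected G (X ∪ Y) → Touch X Y
  touch-of-connected-∪ {X} {Y} (x , x∈X) (y , y∈Y) c with y ∈? X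
  ... | yes y∈X = inj₁ (y , y∈X , y∈Y)
  ... | no y∉X with reach-exit (c x y (p⊆p∪q Y x∈X) (q⊆p∪q X Y y∈Y)) x∈X y∉X
  ...   | p , q , p∈X , q∉X , q∈X∪Y , e =
          inj₂ (p , q , p∈X , [ ⊥-elim ∘ q∉X , id ]′ (x∈p∪q⁻ X Y q∈X∪Y) , e)

  compatible-sym : Compatible G X Y → Compatible G Y X
  compatible-sym (inj₁ X⊆Y) = inj₂ (inj₁ X⊆Y)
  compatible-sym (inj₂ (inj₁ Y⊆X)) = inj₁ Y⊆X
  compatible-sym {X} {Y} (inj₂ (inj₂ ¬tube)) =
    inj₂ (inj₂ (¬tube ∘ subst (Tube G) (∪-comm Y X)))

  compatible-if-touching⇒nested : Tube G X → Tube G Y → (Touch X Y → X ⊆ Y ⊎ Y ⊆ X)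
                                → Compatible G X Y
  compatible-if-touching⇒nested {X} {Y} (neX , _) (neY , _) nested with X ⊆? Y | Y ⊆? X
  ... | yes X⊆Y | _ = inj₁ X⊆Y
  ... | no _ | yes Y⊆X = inj₂ (inj₁ Y⊆X)
  ... | no X⊈Y | no Y⊈X =
        inj₂ (inj₂ λ (_ , c) → [ X⊈Y , Y⊈X ]′ (nested (touch-of-connected-∪ neX neY c)))

  maximal-tubing-closed : IsMaximalTubing G T → Tube G Y → (∀ Z → Z ∈ₛ T → Compatible G Y Z)
                        → Y ∈ₛ T
  maximal-tubing-closed {T} {Y} ((tubes , compatible) , maximal) tY cY =
    maximal (insert Y T) (tubes′ , compatible′) (λ _ → ∈-insert⁺ T Y) Y (∈-insert-self T Y)
    where
    tubes′ : ∀ X → X ∈ₛ insert Y T → Tube G X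
    tubes′ X X∈ with ∈-insert⁻ T Y X X∈
    ... | inj₁ X∈T = tubes X X∈T
    ... | inj₂ refl = tY

    compatible′ : ∀ X Z → X ∈ₛ insert Y T → Z ∈ₛ insert Y T → Compatible G X Z
    compatible′ X Z X∈ Z∈ with ∈-insert⁻ T Y X X∈ | ∈-insert⁻ T Y Z Z∈
    ... | inj₁ X∈T | inj₁ Z∈T = compatible X Z X∈T Z∈T
    ... | inj₁ X∈T | inj₂ refl = compatible-sym (cY X X∈T)
    ... | inj₂ refl | inj₁ Z∈T = cY Z Z∈T
    ... | inj₂ refl | inj₂ refl = inj₁ id

  ⊤∈maximal-tubing : IsMaximalTubing G T → Tube G ⊤ → ⊤ ∈ₛ T
  ⊤∈maximal-tubing T-max ⊤-tube = maximal-tubing-closed T-max ⊤-tube λ _ _ → inj₂ (inj₁ ⊆⊤)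

  ClosedIn : Subset n → Subset n → Set
  ClosedIn W Y = ∀ {u v} → u ∈ Y → G u v → v ∈ W → v ∈ Y

  component : b ∈ W → ∃ λ Y → (Tube G Y × b ∈ Y × Y ⊆ W) × ClosedIn W Y
  component {b} {W} b∈W =
    descend ⊃-wellFounded grow (((b , x∈⁅x⁆ b) , connected-⁅⁆) , x∈⁅x⁆ b , ⁅x⁆⊆ b∈W)
    where
    Grown : Subset n → Set
    Grown Y = Tube G Y × b ∈ Y × Y ⊆ W

    extend : Grown Y → u ∈ Y → G u v → v ∈ W → Grown (Y ∪ ⁅ v ⁆)
    extend {Y} ((neY , cY) , b∈Y , Y⊆W) u∈Y e v∈W =
      (map₂ (p⊆p∪q _) neY , connected-∪ cY connected-⁅⁆ (inj₂ (_ , _ , u∈Y , x∈⁅x⁆ _ , e))) ,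
      p⊆p∪q _ b∈Y ,
      [ Y⊆W , ⁅x⁆⊆ v∈W ]′ ∘ x∈p∪q⁻ Y _

    grow : Grown Y → (∃ λ Y′ → Y ⊂ Y′ × Grown Y′) ⊎ (Grown Y × ClosedIn W Y)
    grow {Y} grown with any? (λ v → v ∈? W ×-dec ¬? (v ∈? Y) ×-dec any? (λ u → u ∈? Y ×-dec G? u v))
    ... | yes (v , v∈W , v∉Y , u , u∈Y , e) = inj₁ (Y ∪ ⁅ v ⁆ , ⊂-∪⁅⁆ v∉Y , extend grown u∈Y e v∈W)
    ... | no ∄v = inj₂ (grown , closed)
      where
      closed : ClosedIn W Y
      closed {u} {v} u∈Y e v∈W with v ∈? Y
      ... | yes v∈Y = v∈Y
      ... | no v∉Y = ⊥-elim (∄v (v , v∈W , v∉Y , u , u∈Y , e))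

  touching-⊆-closed : ClosedIn W Y → Connected G Z → Z ⊆ W → Touch Y Z → Z ⊆ Y
  touching-⊆-closed {W} {Y} {Z} closed cZ Z⊆W t = λ v∈Z → absorb (common t) v∈Z
    where
    common : Touch Y Z → ∃ λ w → w ∈ Y × w ∈ Z
    common (inj₁ shared) = shared
    common (inj₂ (u , w , u∈Y , w∈Z , e)) = w , closed u∈Y e (Z⊆W w∈Z) , w∈Z

    absorb : (∃ λ w → w ∈ Y × w ∈ Z) → Z ⊆ Y
    absorb (w , w∈Y , w∈Z) {v} v∈Z with v ∈? Y
    ... | yes v∈Y = v∈Y
    ... | no v∉Y with reach-exit (cZ w v w∈Z v∈Z) w∈Y v∉Y
    ...   | p , q , p∈Y , q∉Y , q∈Z , e = ⊥-elim (q∉Y (closed p∈Y e (Z⊆W q∈Z)))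

  module Tubing {T : SetOfSubsets n} (T-tubing : IsTubing G T) where

    tube : X ∈ₛ T → Tube G X
    tube = proj₁ T-tubing _

    connected : X ∈ₛ T → Connected G X
    connected = proj₂ ∘ tube

    touching⇒nested : X ∈ₛ T → Y ∈ₛ T → Touch X Y → X ⊆ Y ⊎ Y ⊆ X
    touching⇒nested {X} {Y} X∈T Y∈T t with proj₂ T-tubing X Y X∈T Y∈T
    ... | inj₁ X⊆Y = inj₁ X⊆Y
    ... | inj₂ (inj₁ Y⊆X) = inj₂ Y⊆X
    ... | inj₂ (inj₂ ¬tube) =
          ⊥-elim (¬tube (map₂ (p⊆p∪q Y) (proj₁ (tube X∈T)) ,
                         connected-∪ (connected X∈T) (connected Y∈T) t))

    smallest-tube : Y ∈ₛ T → x ∈ Y → ∃ (IsSmallestTube T x)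
    smallest-tube {x = x} Y∈T x∈Y = descend ⊂-wellFounded shrink (Y∈T , x∈Y)
      where
      shrink : Y ∈ₛ T × x ∈ Y → (∃ λ Z → Z ⊂ Y × Z ∈ₛ T × x ∈ Z) ⊎ IsSmallestTube T x Y
      shrink {Y} (Y∈T , x∈Y) with anySubset? (λ Z → T Z Bool.≟ true ×-dec x ∈? Z ×-dec Z ⊂? Y)
      ... | yes (Z , Z∈T , x∈Z , Z⊂Y) = inj₁ (Z , Z⊂Y , Z∈T , x∈Z)
      ... | no ∄Z = inj₂ (Y∈T , x∈Y , minimal)
        where
        minimal : ∀ Z → Z ∈ₛ T → x ∈ Z → Y ⊆ Z
        minimal Z Z∈T x∈Z with touching⇒nested Y∈T Z∈T (inj₁ (x , x∈Y , x∈Z))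
        ... | inj₁ Y⊆Z = Y⊆Z
        ... | inj₂ Z⊆Y = ⊆∧⊄⇒⊇ Z⊆Y λ Z⊂Y → ∄Z (Z , Z∈T , x∈Z , Z⊂Y)

    ⊆-smallest-of-neighbour : IsSmallestTube T y Z → Y ∈ₛ T → x ∈ Y → G x y → y ∉ Y → Y ⊆ Z
    ⊆-smallest-of-neighbour Sy Y∈T x∈Y e y∉Y
      with touching⇒nested Y∈T (smallest-∈ₛ Sy) (inj₂ (_ , _ , x∈Y , smallest-∋ Sy , e))
    ... | inj₁ Y⊆Z = Y⊆Z
    ... | inj₂ Z⊆Y = ⊥-elim (y∉Y (Z⊆Y (smallest-∋ Sy)))

    module Rooted (⊤∈T : ⊤ ∈ₛ T) where

      infix 30 ↓_
      ↓_ : Fin n → Subset n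
      ↓ x = proj₁ (smallest-tube ⊤∈T (∈⊤ {x = x}))

      ↓-smallest : ∀ x → IsSmallestTube T x (↓ x)
      ↓-smallest x = proj₂ (smallest-tube ⊤∈T ∈⊤)

      ↓∈T : ∀ x → ↓ x ∈ₛ T
      ↓∈T = smallest-∈ₛ ∘ ↓-smallest

      x∈↓x : ∀ x → x ∈ ↓ x
      x∈↓x = smallest-∋ ∘ ↓-smallest

      ∈↓⇒≤ : x ∈ ↓ y → x ≤[ T ] y
      ∈↓⇒≤ {y = y} x∈↓y = ↓ y , ↓-smallest y , x∈↓y

      escape : Y ∈ₛ T → Connected G X → x ∈ X → x ∈ Y → y ∈ X → y ∉ Y
             → ∃ λ q → q ∈ X × q ∉ Y × Y ⊆ ↓ q
      escape Y∈T cX x∈X x∈Y y∈X y∉Y with reach-exit (cX _ _ x∈X y∈X) x∈Y y∉Y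
      ... | p , q , p∈Y , q∉Y , q∈X , e =
            q , q∈X , q∉Y , ⊆-smallest-of-neighbour (↓-smallest q) Y∈T p∈Y e q∉Y

      tube-is-smallest : X ∈ₛ T → ∃ λ x → IsSmallestTube T x X
      tube-is-smallest {X} X∈T with proj₁ (tube X∈T)
      ... | x , x∈X = proj₂ (descend ⊃-wellFounded climb (x , x∈X , ↓-smallest x))
        where
        Climbing : Subset n → Set
        Climbing Z = ∃ λ x → x ∈ X × IsSmallestTube T x Z

        climb : Climbing Z → (∃ λ Z′ → Z ⊂ Z′ × Climbing Z′) ⊎ (∃ λ x → IsSmallestTube T x X)
        climb {Z} (x , x∈X , Sx) with any? (λ y → y ∈? X ×-dec Z ⊂? ↓ y)
        ... | yes (y , y∈X , Z⊂↓y) = inj₁ (↓ y , Z⊂↓y , y , y∈X , ↓-smallest y)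
        ... | no ∄y = inj₂ (x , X∈T , x∈X , λ Y Y∈T x∈Y → ⊆-trans X⊆Z (smallest-minimal Sx Y∈T x∈Y))
          where
          X⊆Z : X ⊆ Z
          X⊆Z {v} v∈X with v ∈? Z
          ... | yes v∈Z = v∈Z
          ... | no v∉Z with escape (smallest-∈ₛ Sx) (connected X∈T) x∈X (smallest-∋ Sx) v∈X v∉Z
          ...   | q , q∈X , q∉Z , Z⊆↓q = ⊥-elim (∄y (q , q∈X , Z⊆↓q , q , x∈↓x q , q∉Z))

  module MaximalTubing {T : SetOfSubsets n} (T-max : IsMaximalTubing G T) where

    open Tubing (proj₁ T-max)

    smallest-injective : IsSmallestTube T b X → IsSmallestTube T j X → b ≡ j
    smallest-injective {b} {X} {j} Sb Sj with b ≟ j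
    ... | yes b≡j = b≡j
    ... | no b≢j = ⊥-elim (component-absurd (component (x∈p∧x≢y⇒x∈p-y (smallest-∋ Sb) b≢j)))
      where
      component-absurd : (∃ λ Y → (Tube G Y × b ∈ Y × Y ⊆ X - j) × ClosedIn (X - j) Y) → ⊥
      component-absurd (Y , (tY , b∈Y , Y⊆X-j) , closed) =
        ⊂-irref refl (⊆-⊂-trans X⊆X-j (x∈p⇒p-x⊂p (smallest-∋ Sj)))
        where
        Y⊆X : Y ⊆ X
        Y⊆X = p─q⊆p X ⁅ j ⁆ ∘ Y⊆X-j

        nested : Z ∈ₛ T → Touch Y Z → Y ⊆ Z ⊎ Z ⊆ Y
        nested {Z} Z∈T t with j ∈? Z
        ... | yes j∈Z = inj₁ (smallest-minimal Sj Z∈T j∈Z ∘ Y⊆X)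
        ... | no j∉Z with touching⇒nested (smallest-∈ₛ Sb) Z∈T (touch-monoˡ Y⊆X t)
        ...   | inj₁ X⊆Z = inj₁ (X⊆Z ∘ Y⊆X)
        ...   | inj₂ Z⊆X = inj₂ (touching-⊆-closed closed (connected Z∈T) Z⊆X-j t)
          where
          Z⊆X-j : Z ⊆ X - j
          Z⊆X-j v∈Z = x∈p∧x≢y⇒x∈p-y (Z⊆X v∈Z) λ { refl → j∉Z v∈Z }

        Y∈T : Y ∈ₛ T
        Y∈T = maximal-tubing-closed T-max tY λ Z Z∈T →
          compatible-if-touching⇒nested tY (tube Z∈T) (nested Z∈T)

        X⊆X-j : X ⊆ X - j
        X⊆X-j = Y⊆X-j ∘ smallest-minimal Sb Y∈T b∈Y

    ≤-antisym : x ≤[ T ] y → y ≤[ T ] x → x ≡ y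
    ≤-antisym {y = y} (Y , Sy , x∈Y) (X , Sx , y∈X) =
      smallest-injective Sx (subst (IsSmallestTube T y) (sym X≡Y) Sy)
      where
      X≡Y : X ≡ Y
      X≡Y = ⊆-antisym (smallest-minimal Sx (smallest-∈ₛ Sy) x∈Y)
                      (smallest-minimal Sy (smallest-∈ₛ Sx) y∈X)

  no-opposite-comparisons : {J K : SetOfSubsets n} → IsMaximalTubing G J → IsMaximalTubing G K
                          → SameInversions J K → x <[ J ] y → y <[ K ] x → ⊥
  no-opposite-comparisons {x = x} {y = y} J-max K-max same (x≤y , x≢y) (y≤x , y≢x) with <-cmp x y
  ... | tri≈ _ x≡y _ = x≢y x≡y
  ... | tri< x<y _ _ =
        x≢y (MaximalTubing.≤-antisym J-max x≤y (Inv⇒≤ (from (same x y) (x<y , y≤x , y≢x))))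
  ... | tri> _ _ y<x =
        y≢x (MaximalTubing.≤-antisym K-max y≤x (Inv⇒≤ (to (same y x) (y<x , x≤y , x≢y))))

  module Comparison (⊤-tube : Tube G ⊤) {J K : SetOfSubsets n}
                    (J-max : IsMaximalTubing G J) (K-max : IsMaximalTubing G K)
                    (same : SameInversions J K) where

    open Tubing (proj₁ J-max) using (connected)
    open Tubing.Rooted (proj₁ K-max) (⊤∈maximal-tubing K-max ⊤-tube) using (escape; ∈↓⇒≤)

    smallest-⊆ : IsSmallestTube J j X → IsSmallestTube K j Y → X ⊆ Y
    smallest-⊆ {j} {X} {Y} SJ SK {i} i∈X with i ∈? Y
    ... | yes i∈Y = i∈Y
    ... | no i∉Y with escape (smallest-∈ₛ SK) (connected (smallest-∈ₛ SJ))
                             (smallest-∋ SJ) (smallest-∋ SK) i∈X i∉Y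
    ...   | b , b∈X , b∉Y , Y⊆↓b =
            ⊥-elim (no-opposite-comparisons J-max K-max same
                      ((X , SJ , b∈X) , b≢j) (∈↓⇒≤ (Y⊆↓b (smallest-∋ SK)) , b≢j ∘ sym))
      where
      b≢j : b ≢ j
      b≢j refl = b∉Y (smallest-∋ SK)

  same-inversions⇒⊆ₛ : {J K : SetOfSubsets n} → Tube G ⊤
                     → IsMaximalTubing G J → IsMaximalTubing G K
                     → SameInversions J K → X ∈ₛ J → X ∈ₛ K
  same-inversions⇒⊆ₛ {X = X} {K = K} ⊤-tube J-max K-max same X∈J
    with Tubing.Rooted.tube-is-smallest (proj₁ J-max) (⊤∈maximal-tubing J-max ⊤-tube) X∈J
  ... | x , SJ = subst (_∈ₛ K) (sym X≡↓x) (↓∈T x)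
    where
    open Tubing.Rooted (proj₁ K-max) (⊤∈maximal-tubing K-max ⊤-tube) using (↓_; ↓-smallest; ↓∈T)
    X≡↓x : X ≡ ↓ x
    X≡↓x = ⊆-antisym
      (Comparison.smallest-⊆ ⊤-tube J-max K-max same SJ (↓-smallest x))
      (Comparison.smallest-⊆ ⊤-tube K-max J-max (SameInversions-sym same) (↓-smallest x) SJ)

  same-inversions⇔same-tubes : {J K : SetOfSubsets n} → Tube G ⊤
                             → IsMaximalTubing G J → IsMaximalTubing G K
                             → SameInversions J K ⇔ SameTubes J K
  same-inversions⇔same-tubes ⊤-tube J-max K-max = mk⇔
    (λ same X → mk⇔ (same-inversions⇒⊆ₛ ⊤-tube J-max K-max same)
                    (same-inversions⇒⊆ₛ ⊤-tube K-max J-max (SameInversions-sym same)))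
    (λ same i j → mk⇔ (Inv-transfer same) (Inv-transfer (SameTubes-sym same)))

module _ {n : ℕ} where

  Cycle-sym : Symmetric (Cycle n)
  Cycle-sym (inj₁ j≡1+i) = inj₂ (inj₁ j≡1+i)
  Cycle-sym (inj₂ (inj₁ i≡1+j)) = inj₁ i≡1+j
  Cycle-sym (inj₂ (inj₂ (inj₁ (i-last , j-first)))) = inj₂ (inj₂ (inj₂ (j-first , i-last)))
  Cycle-sym (inj₂ (inj₂ (inj₂ (i-first , j-last)))) = inj₂ (inj₂ (inj₁ (j-last , i-first)))

  Cycle? : Decidable (Cycle n)
  Cycle? i j =
    toℕ j ℕ.≟ suc (toℕ i) ⊎-dec toℕ i ℕ.≟ suc (toℕ j)
    ⊎-dec (suc (toℕ i) ℕ.≟ n ×-dec toℕ j ℕ.≟ 0) ⊎-dec (toℕ i ℕ.≟ 0 ×-dec suc (toℕ j) ℕ.≟ n)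

  Cycle-walk-up : ∀ k {x y : Fin n} → toℕ y ≡ k + toℕ x → Reach (Cycle n) ⊤ x y
  Cycle-walk-up zero {x} y≡x rewrite toℕ-injective y≡x = here ∈⊤
  Cycle-walk-up (suc k) {x} {y} y≡ = step ∈⊤ (inj₁ (toℕ-fromℕ< x+1<n)) (Cycle-walk-up k y≡′)
    where
    x+1<n : suc (toℕ x) ℕ.< n
    x+1<n = ≤-<-trans (subst (suc (toℕ x) ≤_) (sym y≡) (ℕ.s≤s (m≤n+m (toℕ x) k))) (toℕ<n y)
    y≡′ : toℕ y ≡ k + toℕ (fromℕ< x+1<n)
    y≡′ = trans y≡ (trans (sym (+-suc k (toℕ x))) (cong (k +_) (sym (toℕ-fromℕ< x+1<n))))

Cycle-⊤-tube : ∀ {n} → Tube (Cycle (suc n)) ⊤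
Cycle-⊤-tube = (Fin.zero , ∈⊤) , λ x y _ _ → reach-reverse Cycle-sym (from-zero x) ◅◅ from-zero y
  where
  from-zero : ∀ {n} (y : Fin (suc n)) → Reach (Cycle (suc n)) ⊤ Fin.zero y
  from-zero y = Cycle-walk-up (toℕ y) (sym (+-identityʳ (toℕ y)))

proposition6p4 : (n : ℕ) → 3 ≤ n → (J K : SetOfSubsets n)
    → IsMaximalTubing (Cycle n) J → IsMaximalTubing (Cycle n) K
    → ((∀ (i j : Fin n) → Inv J i j ⇔ Inv K i j) ⇔ (∀ (X : Subset n) → X ∈ₛ J ⇔ X ∈ₛ K))
-- The bound 3 ≤ n is only needed to make the vertex set nonempty.
proposition6p4 zero ()
proposition6p4 (suc n) _ J K =
  Tubes.same-inversions⇔same-tubes (Cycle (suc n)) Cycle-sym Cycle? Cycle-⊤-tube
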